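{- The subvariety $\mathsf{V}$ of $V(\mathsf{BCA})$ axiomatised relative to $V(\mathsf{BCA})$ by the identity $J_2\neg x\approx\neg J_2x$ coincides with the join $\mathsf{BA}\vee\mathsf{SL}$ in the lattice of subvarieties of $V(\mathsf{BCA})$.
   Context: $\mathbf{WK}^e$ is the algebra on $\{0,\tfrac12,1\}$ of type $\langle\wedge,\vee,\neg,J_2,0,1\rangle$ with $\neg0=1,\neg\tfrac12=\tfrac12,\neg1=0$; $\vee,\wedge$ Boolean on $\{0,1\}$ and outputting $\tfrac12$ whenever an argument is $\tfrac12$; $J_21=1$, $J_2\tfrac12=J_20=0$. $\mathsf{BCA}=ISP(\mathbf{WK}^e)$ and $V(\mathsf{BCA})$ is the variety it generates. $\mathsf{BA}$ and $\mathsf{SL}$ are the subvarieties of $V(\mathsf{BCA})$ axiomatised relative to $V(\mathsf{BCA})$ by $J_2x\approx x$ and $J_2x\approx1$, respectively. -}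

module Defs where

open import Data.Nat using (ℕ)
open import Data.Product using (_×_)
open import Level using (Lift)
import Level
open import Relation.Binary.PropositionalEquality using (_≡_)

infixr 6 _∧ₜ_
infixr 5 _∨ₜ_
infix 7 ¬ₜ_
data Term : Set where
  var  : ℕ → Term
  _∧ₜ_ : Term → Term → Term
  _∨ₜ_ : Term → Term → Term
  ¬ₜ_  : Term → Term
  J₂ₜ  : Term → Term
  0ₜ   : Term
  1ₜ   : Term

record Algebra : Set₁ where
  field
    Carrier : Set
    _∧_ : Carrier → Carrier → Carrier
    _∨_ : Carrier → Carrier → Carrier
    ¬_  : Carrier → Carrier
    J₂  : Carrier → Carrier
    𝟎   : Carrier
    𝟏   : Carrier

open Algebra public

⟦_⟧ : Term → (A : Algebra) → (ℕ → Carrier A) → Carrier A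
⟦ var n ⟧   A ρ = ρ n
⟦ s ∧ₜ t ⟧  A ρ = _∧_ A (⟦ s ⟧ A ρ) (⟦ t ⟧ A ρ)
⟦ s ∨ₜ t ⟧  A ρ = _∨_ A (⟦ s ⟧ A ρ) (⟦ t ⟧ A ρ)
⟦ ¬ₜ s ⟧    A ρ = ¬_ A (⟦ s ⟧ A ρ)
⟦ J₂ₜ s ⟧   A ρ = J₂ A (⟦ s ⟧ A ρ)
⟦ 0ₜ ⟧      A ρ = 𝟎 A
⟦ 1ₜ ⟧      A ρ = 𝟏 A

infix 4 _⊨_≈_
_⊨_≈_ : Algebra → Term → Term → Set
A ⊨ s ≈ t = ∀ (ρ : ℕ → Carrier A) → ⟦ s ⟧ A ρ ≡ ⟦ t ⟧ A ρ

Class : Set₂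
Class = Algebra → Set₁

-- Id(K): the identities true in every member of K;  Mod: the models.
-- The variety generated by K is Mod(Id(K)) (Birkhoff's HSP theorem).
Id : Class → Term → Term → Set₁
Id K s t = ∀ (B : Algebra) → K B → B ⊨ s ≈ t

-- The three-element algebra WK^e on {0, 1/2, 1}.
data Three : Set where
  o h i : Three

∧₃ : Three → Three → Three
∧₃ h _ = h
∧₃ _ h = h
∧₃ i i = i
∧₃ i o = o
∧₃ o i = o
∧₃ o o = o

∨₃ : Three → Three → Three
∨₃ h _ = h
∨₃ _ h = h
∨₃ o o = o
∨₃ o i = i
∨₃ i o = i
∨₃ i i = i

¬₃ : Three → Three
¬₃ o = i
¬₃ h = h
¬₃ i = o

J₂₃ : Three → Three
J₂₃ i = i
J₂₃ h = o
J₂₃ o = o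

WKe : Algebra
WKe = record
  { Carrier = Three ; _∧_ = ∧₃ ; _∨_ = ∨₃ ; ¬_ = ¬₃ ; J₂ = J₂₃ ; 𝟎 = o ; 𝟏 = i }

-- V(BCA) = V(WK^e) = Mod(Id(WK^e)): algebras satisfying every identity of WK^e.
VBCA : Class
VBCA A = Lift (Level.suc Level.zero) (∀ (s t : Term) → WKe ⊨ s ≈ t → A ⊨ s ≈ t)

x₀ : Term
x₀ = var 0

BA : Class
BA A = VBCA A × Lift (Level.suc Level.zero) (A ⊨ J₂ₜ x₀ ≈ x₀)

SL : Class
SL A = VBCA A × Lift (Level.suc Level.zero) (A ⊨ J₂ₜ x₀ ≈ 1ₜ)

𝕍 : Class
𝕍 A = VBCA A × Lift (Level.suc Level.zero) (A ⊨ J₂ₜ (¬ₜ x₀) ≈ ¬ₜ (J₂ₜ x₀))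

-- Join of two varieties in the lattice of varieties: the smallest variety
-- containing both, i.e. Mod(Id(K) ∩ Id(L)).
_⊔ᵛ_ : Class → Class → Class
(K ⊔ᵛ L) A = ∀ (s t : Term) → Id K s t → Id L s t → Lift (Level.suc Level.zero) (A ⊨ s ≈ t)

_≐_ : Class → Class → Set₁
K ≐ L = ∀ (A : Algebra) → (K A → L A) × (L A → K A)

-- Every algebra of V(BCA) satisfies  x ≈ J₂x ∧ (x ∨ 1).  The map  x ↦ x ∨ 1  is idempotent
-- with kernel a congruence, and its fixed points, with the induced operations, form a
-- homomorphic image lying in SL.  Under  J₂¬x ≈ ¬J₂x,  De Morgan makes J₂ preserve ∨ as well,
-- so J₂ is an idempotent endomorphism whose image lies in BA.  An identity valid in BA ⊔ SL
-- thus holds after applying J₂ and after applying  _ ∨ 1,  hence holds outright.  Conversely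
-- J₂¬x ≈ ¬J₂x  holds in BA trivially and in SL because  1 = J₂0 = 0  there.
module Submission where

open import Defs
open import Axiom.UniquenessOfIdentityProofs.WithK using (uip)
open import Data.Empty using (⊥)
open import Data.Nat using (ℕ; zero; suc)
open import Data.Product using (Σ; _×_; _,_; proj₁; proj₂)
open import Data.Product.Properties using (Σ-≡,≡→≡)
open import Data.Unit using (⊤)
open import Function using (_∘_)
open import Level using (lift; lower)
open import Relation.Binary.Definitions using (DecidableEquality)
open import Relation.Binary.PropositionalEquality
open import Relation.Nullary.Decidable using (Dec; yes; no; True; toWitness; map′; _×-dec_)

x₁ : Term
x₁ = var 1

⟨_,_⟩ : {C : Set} → C → C → ℕ → C
⟨ a , b ⟩ zero    = a
⟨ a , b ⟩ (suc _) = b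

InXY : Term → Set
InXY (var 0)   = ⊤
InXY (var 1)   = ⊤
InXY (var _)   = ⊥
InXY (s ∧ₜ t)  = InXY s × InXY t
InXY (s ∨ₜ t)  = InXY s × InXY t
InXY (¬ₜ s)    = InXY s
InXY (J₂ₜ s)   = InXY s
InXY 0ₜ        = ⊤
InXY 1ₜ        = ⊤

⟦⟧-InXY : ∀ (A : Algebra) s ρ → InXY s → ⟦ s ⟧ A ρ ≡ ⟦ s ⟧ A ⟨ ρ 0 , ρ 1 ⟩
⟦⟧-InXY A (var 0)  ρ _ = refl
⟦⟧-InXY A (var 1)  ρ _ = refl
⟦⟧-InXY A (s ∧ₜ t) ρ (p , q) = cong₂ (_∧_ A) (⟦⟧-InXY A s ρ p) (⟦⟧-InXY A t ρ q)
⟦⟧-InXY A (s ∨ₜ t) ρ (p , q) = cong₂ (_∨_ A) (⟦⟧-InXY A s ρ p) (⟦⟧-InXY A t ρ q)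
⟦⟧-InXY A (¬ₜ s)   ρ p = cong (¬_ A) (⟦⟧-InXY A s ρ p)
⟦⟧-InXY A (J₂ₜ s)  ρ p = cong (J₂ A) (⟦⟧-InXY A s ρ p)
⟦⟧-InXY A 0ₜ       ρ _ = refl
⟦⟧-InXY A 1ₜ       ρ _ = refl

_≟₃_ : DecidableEquality Three
o ≟₃ o = yes refl
h ≟₃ h = yes refl
i ≟₃ i = yes refl
o ≟₃ h = no λ ()
o ≟₃ i = no λ ()
h ≟₃ o = no λ ()
h ≟₃ i = no λ ()
i ≟₃ o = no λ ()
i ≟₃ h = no λ ()

∀₃? : {P : Three → Set} → (∀ a → Dec (P a)) → Dec (∀ a → P a)
∀₃? P? = map′ (λ { (po , ph , pi) → λ { o → po ; h → ph ; i → pi } })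
              (λ p → p o , p h , p i)
              (P? o ×-dec P? h ×-dec P? i)

truthTable? : (s t : Term) → Dec (∀ a b → ⟦ s ⟧ WKe ⟨ a , b ⟩ ≡ ⟦ t ⟧ WKe ⟨ a , b ⟩)
truthTable? s t = ∀₃? λ a → ∀₃? λ b → ⟦ s ⟧ WKe ⟨ a , b ⟩ ≟₃ ⟦ t ⟧ WKe ⟨ a , b ⟩

-- All three implicit arguments are solved by normalisation for closed terms, so a two-variable
-- identity of WKe is established by evaluating its truth table.
WKe-⊨-byTruthTable : ∀ s t → {InXY s} → {InXY t} → {True (truthTable? s t)} → WKe ⊨ s ≈ t
WKe-⊨-byTruthTable s t {p} {q} {table} ρ = begin
  ⟦ s ⟧ WKe ρ                  ≡⟨ ⟦⟧-InXY WKe s ρ p ⟩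
  ⟦ s ⟧ WKe ⟨ ρ 0 , ρ 1 ⟩      ≡⟨ toWitness table (ρ 0) (ρ 1) ⟩
  ⟦ t ⟧ WKe ⟨ ρ 0 , ρ 1 ⟩      ≡⟨ ⟦⟧-InXY WKe t ρ q ⟨
  ⟦ t ⟧ WKe ρ                  ∎
  where open ≡-Reasoning

record Hom (A B : Algebra) : Set where
  field
    map     : Carrier A → Carrier B
    ∧-homo  : ∀ a b → map (_∧_ A a b) ≡ _∧_ B (map a) (map b)
    ∨-homo  : ∀ a b → map (_∨_ A a b) ≡ _∨_ B (map a) (map b)
    ¬-homo  : ∀ a → map (¬_ A a) ≡ ¬_ B (map a)
    J₂-homo : ∀ a → map (J₂ A a) ≡ J₂ B (map a)
    𝟎-homo  : map (𝟎 A) ≡ 𝟎 B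
    𝟏-homo  : map (𝟏 A) ≡ 𝟏 B

open Hom

⟦⟧-cong : ∀ (A : Algebra) t {ρ σ} → (∀ n → ρ n ≡ σ n) → ⟦ t ⟧ A ρ ≡ ⟦ t ⟧ A σ
⟦⟧-cong A (var n)  ρ≗σ = ρ≗σ n
⟦⟧-cong A (s ∧ₜ t) ρ≗σ = cong₂ (_∧_ A) (⟦⟧-cong A s ρ≗σ) (⟦⟧-cong A t ρ≗σ)
⟦⟧-cong A (s ∨ₜ t) ρ≗σ = cong₂ (_∨_ A) (⟦⟧-cong A s ρ≗σ) (⟦⟧-cong A t ρ≗σ)
⟦⟧-cong A (¬ₜ s)   ρ≗σ = cong (¬_ A) (⟦⟧-cong A s ρ≗σ)
⟦⟧-cong A (J₂ₜ s)  ρ≗σ = cong (J₂ A) (⟦⟧-cong A s ρ≗σ)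
⟦⟧-cong A 0ₜ       ρ≗σ = refl
⟦⟧-cong A 1ₜ       ρ≗σ = refl

⟦⟧-homo : ∀ {A B} (f : Hom A B) t ρ → map f (⟦ t ⟧ A ρ) ≡ ⟦ t ⟧ B (map f ∘ ρ)
⟦⟧-homo f (var n)  ρ = refl
⟦⟧-homo {B = B} f (s ∧ₜ t) ρ =
  trans (∧-homo f _ _) (cong₂ (_∧_ B) (⟦⟧-homo f s ρ) (⟦⟧-homo f t ρ))
⟦⟧-homo {B = B} f (s ∨ₜ t) ρ =
  trans (∨-homo f _ _) (cong₂ (_∨_ B) (⟦⟧-homo f s ρ) (⟦⟧-homo f t ρ))
⟦⟧-homo {B = B} f (¬ₜ s)  ρ = trans (¬-homo f _) (cong (¬_ B) (⟦⟧-homo f s ρ))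
⟦⟧-homo {B = B} f (J₂ₜ s) ρ = trans (J₂-homo f _) (cong (J₂ B) (⟦⟧-homo f s ρ))
⟦⟧-homo f 0ₜ ρ = 𝟎-homo f
⟦⟧-homo f 1ₜ ρ = 𝟏-homo f

⊨-homImage : ∀ {A B s t} (f : Hom A B) (σ : Carrier B → Carrier A) →
             (∀ b → map f (σ b) ≡ b) → A ⊨ s ≈ t → B ⊨ s ≈ t
⊨-homImage {A} {B} {s} {t} f σ f∘σ≗id A⊨s≈t ρ = begin
  ⟦ s ⟧ B ρ                ≡⟨ ⟦⟧-cong B s (λ n → sym (f∘σ≗id (ρ n))) ⟩
  ⟦ s ⟧ B (map f ∘ σ ∘ ρ)  ≡⟨ ⟦⟧-homo f s (σ ∘ ρ) ⟨
  map f (⟦ s ⟧ A (σ ∘ ρ))  ≡⟨ cong (map f) (A⊨s≈t (σ ∘ ρ)) ⟩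
  map f (⟦ t ⟧ A (σ ∘ ρ))  ≡⟨ ⟦⟧-homo f t (σ ∘ ρ) ⟩
  ⟦ t ⟧ B (map f ∘ σ ∘ ρ)  ≡⟨ ⟦⟧-cong B t (λ n → f∘σ≗id (ρ n)) ⟩
  ⟦ t ⟧ B ρ                ∎
  where open ≡-Reasoning

⊨-kernel : ∀ {A B s t} (f : Hom A B) → B ⊨ s ≈ t →
           ∀ ρ → map f (⟦ s ⟧ A ρ) ≡ map f (⟦ t ⟧ A ρ)
⊨-kernel {s = s} {t} f B⊨s≈t ρ =
  trans (⟦⟧-homo f s ρ) (trans (B⊨s≈t _) (sym (⟦⟧-homo f t ρ)))

record IsCompatibleRetraction (A : Algebra) (g : Carrier A → Carrier A) : Set where
  field
    idem      : ∀ a → g (g a) ≡ g a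
    ∧-compat  : ∀ a b → g (_∧_ A a b) ≡ g (_∧_ A (g a) (g b))
    ∨-compat  : ∀ a b → g (_∨_ A a b) ≡ g (_∨_ A (g a) (g b))
    ¬-compat  : ∀ a → g (¬_ A a) ≡ g (¬_ A (g a))
    J₂-compat : ∀ a → g (J₂ A a) ≡ g (J₂ A (g a))

idempotentEndo⇒retraction : ∀ {A} (f : Hom A A) → (∀ a → map f (map f a) ≡ map f a) →
                            IsCompatibleRetraction A (map f)
idempotentEndo⇒retraction {A} f idem = record
  { idem      = idem
  ; ∧-compat  = λ a b → compat₂ (_∧_ A) (∧-homo f) a b
  ; ∨-compat  = λ a b → compat₂ (_∨_ A) (∨-homo f) a b
  ; ¬-compat  = λ a → compat₁ (¬_ A) (¬-homo f) a
  ; J₂-compat = λ a → compat₁ (J₂ A) (J₂-homo f) a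
  }
  where
  g : Carrier A → Carrier A
  g = map f
  compat₁ : (op : Carrier A → Carrier A) → (∀ a → g (op a) ≡ op (g a)) →
            ∀ a → g (op a) ≡ g (op (g a))
  compat₁ op homo a = trans (homo a) (trans (cong op (sym (idem a))) (sym (homo (g a))))
  compat₂ : (op : Carrier A → Carrier A → Carrier A) → (∀ a b → g (op a b) ≡ op (g a) (g b)) →
            ∀ a b → g (op a b) ≡ g (op (g a) (g b))
  compat₂ op homo a b =
    trans (homo a b) (trans (cong₂ op (sym (idem a)) (sym (idem b))) (sym (homo (g a) (g b))))

module FixedPoints (A : Algebra) {g : Carrier A → Carrier A}
                   (retraction : IsCompatibleRetraction A g) where
  open IsCompatibleRetraction retraction

  Fixed : Set
  Fixed = Σ (Carrier A) λ a → g a ≡ a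

  fixed-≡ : {b c : Fixed} → proj₁ b ≡ proj₁ c → b ≡ c
  fixed-≡ p = Σ-≡,≡→≡ (p , uip _ _)

  retract : Carrier A → Fixed
  retract a = g a , idem a

  Fix : Algebra
  Fix = record
    { Carrier = Fixed
    ; _∧_ = λ b c → retract (_∧_ A (proj₁ b) (proj₁ c))
    ; _∨_ = λ b c → retract (_∨_ A (proj₁ b) (proj₁ c))
    ; ¬_  = λ b → retract (¬_ A (proj₁ b))
    ; J₂  = λ b → retract (J₂ A (proj₁ b))
    ; 𝟎   = retract (𝟎 A)
    ; 𝟏   = retract (𝟏 A)
    }

  retractHom : Hom A Fix
  retractHom = record
    { map     = retract
    ; ∧-homo  = λ a b → fixed-≡ (∧-compat a b)
    ; ∨-homo  = λ a b → fixed-≡ (∨-compat a b)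
    ; ¬-homo  = λ a → fixed-≡ (¬-compat a)
    ; J₂-homo = λ a → fixed-≡ (J₂-compat a)
    ; 𝟎-homo  = refl
    ; 𝟏-homo  = refl
    }

  retract-proj₁ : ∀ b → retract (proj₁ b) ≡ b
  retract-proj₁ b = fixed-≡ (proj₂ b)

  VBCA-Fix : VBCA A → VBCA Fix
  VBCA-Fix v = lift λ s t WKe⊨s≈t →
    ⊨-homImage {s = s} {t} retractHom proj₁ retract-proj₁ (lower v s t WKe⊨s≈t)

  Fix-⊨⇒ : ∀ {s t} → Fix ⊨ s ≈ t → ∀ ρ → g (⟦ s ⟧ A ρ) ≡ g (⟦ t ⟧ A ρ)
  Fix-⊨⇒ {s} {t} Fix⊨s≈t ρ = cong proj₁ (⊨-kernel {s = s} {t} retractHom Fix⊨s≈t ρ)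

module VBCA-Algebra {A : Algebra} (v : VBCA A) where
  open Algebra A using () renaming
    (_∧_ to infixr 6 _∧ᴬ_; _∨_ to infixr 5 _∨ᴬ_; ¬_ to infix 7 ¬ᴬ_; J₂ to J₂ᴬ; 𝟎 to 𝟎ᴬ; 𝟏 to 𝟏ᴬ)

  holds : ∀ s t → {InXY s} → {InXY t} → {True (truthTable? s t)} → A ⊨ s ≈ t
  holds s t {p} {q} {table} = lower v s t (WKe-⊨-byTruthTable s t {p} {q} {table})

  J₂-idem : ∀ a → J₂ᴬ (J₂ᴬ a) ≡ J₂ᴬ a
  J₂-idem a = holds (J₂ₜ (J₂ₜ x₀)) (J₂ₜ x₀) λ _ → a

  J₂-∧ : ∀ a b → J₂ᴬ (a ∧ᴬ b) ≡ J₂ᴬ a ∧ᴬ J₂ᴬ b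
  J₂-∧ a b = holds (J₂ₜ (x₀ ∧ₜ x₁)) (J₂ₜ x₀ ∧ₜ J₂ₜ x₁) ⟨ a , b ⟩

  J₂-𝟎 : J₂ᴬ 𝟎ᴬ ≡ 𝟎ᴬ
  J₂-𝟎 = holds (J₂ₜ 0ₜ) 0ₜ λ _ → 𝟎ᴬ

  J₂-𝟏 : J₂ᴬ 𝟏ᴬ ≡ 𝟏ᴬ
  J₂-𝟏 = holds (J₂ₜ 1ₜ) 1ₜ λ _ → 𝟏ᴬ

  ¬-𝟏 : ¬ᴬ 𝟏ᴬ ≡ 𝟎ᴬ
  ¬-𝟏 = holds (¬ₜ 1ₜ) 0ₜ λ _ → 𝟏ᴬ

  ∨-deMorgan : ∀ a b → a ∨ᴬ b ≡ ¬ᴬ (¬ᴬ a ∧ᴬ ¬ᴬ b)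
  ∨-deMorgan a b = holds (x₀ ∨ₜ x₁) (¬ₜ (¬ₜ x₀ ∧ₜ ¬ₜ x₁)) ⟨ a , b ⟩

  J₂∧∨𝟏-split : ∀ a → a ≡ J₂ᴬ a ∧ᴬ (a ∨ᴬ 𝟏ᴬ)
  J₂∧∨𝟏-split a = holds x₀ (J₂ₜ x₀ ∧ₜ (x₀ ∨ₜ 1ₜ)) λ _ → a

  J₂-∨𝟏 : ∀ a → J₂ᴬ a ∨ᴬ 𝟏ᴬ ≡ 𝟏ᴬ ∨ᴬ 𝟏ᴬ
  J₂-∨𝟏 a = holds (J₂ₜ x₀ ∨ₜ 1ₜ) (1ₜ ∨ₜ 1ₜ) λ _ → a

  ∨𝟏-retraction : IsCompatibleRetraction A (_∨ᴬ 𝟏ᴬ)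
  ∨𝟏-retraction = record
    { idem      = λ a → holds ((x₀ ∨ₜ 1ₜ) ∨ₜ 1ₜ) (x₀ ∨ₜ 1ₜ) λ _ → a
    ; ∧-compat  = λ a b → holds ((x₀ ∧ₜ x₁) ∨ₜ 1ₜ) (((x₀ ∨ₜ 1ₜ) ∧ₜ (x₁ ∨ₜ 1ₜ)) ∨ₜ 1ₜ) ⟨ a , b ⟩
    ; ∨-compat  = λ a b → holds ((x₀ ∨ₜ x₁) ∨ₜ 1ₜ) (((x₀ ∨ₜ 1ₜ) ∨ₜ (x₁ ∨ₜ 1ₜ)) ∨ₜ 1ₜ) ⟨ a , b ⟩
    ; ¬-compat  = λ a → holds (¬ₜ x₀ ∨ₜ 1ₜ) (¬ₜ (x₀ ∨ₜ 1ₜ) ∨ₜ 1ₜ) λ _ → a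
    ; J₂-compat = λ a → holds (J₂ₜ x₀ ∨ₜ 1ₜ) (J₂ₜ (x₀ ∨ₜ 1ₜ) ∨ₜ 1ₜ) λ _ → a
    }

  module SemilatticePart = FixedPoints A ∨𝟏-retraction

  SL-SemilatticePart : SL SemilatticePart.Fix
  SL-SemilatticePart =
    SemilatticePart.VBCA-Fix v , lift λ ρ → SemilatticePart.fixed-≡ (J₂-∨𝟏 (proj₁ (ρ 0)))

  module _ (J₂-¬ : ∀ a → J₂ᴬ (¬ᴬ a) ≡ ¬ᴬ J₂ᴬ a) where

    J₂-∨ : ∀ a b → J₂ᴬ (a ∨ᴬ b) ≡ J₂ᴬ a ∨ᴬ J₂ᴬ b
    J₂-∨ a b = begin
      J₂ᴬ (a ∨ᴬ b)                  ≡⟨ cong J₂ᴬ (∨-deMorgan a b) ⟩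
      J₂ᴬ (¬ᴬ (¬ᴬ a ∧ᴬ ¬ᴬ b))       ≡⟨ J₂-¬ _ ⟩
      ¬ᴬ J₂ᴬ (¬ᴬ a ∧ᴬ ¬ᴬ b)         ≡⟨ cong ¬ᴬ_ (J₂-∧ _ _) ⟩
      ¬ᴬ (J₂ᴬ (¬ᴬ a) ∧ᴬ J₂ᴬ (¬ᴬ b)) ≡⟨ cong₂ (λ c d → ¬ᴬ (c ∧ᴬ d)) (J₂-¬ a) (J₂-¬ b) ⟩
      ¬ᴬ (¬ᴬ J₂ᴬ a ∧ᴬ ¬ᴬ J₂ᴬ b)     ≡⟨ ∨-deMorgan _ _ ⟨
      J₂ᴬ a ∨ᴬ J₂ᴬ b                ∎
      where open ≡-Reasoning

    J₂-endo : Hom A A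
    J₂-endo = record
      { map = J₂ᴬ ; ∧-homo = J₂-∧ ; ∨-homo = J₂-∨ ; ¬-homo = J₂-¬ ; J₂-homo = λ _ → refl
      ; 𝟎-homo = J₂-𝟎 ; 𝟏-homo = J₂-𝟏 }

    module BooleanPart = FixedPoints A (idempotentEndo⇒retraction J₂-endo J₂-idem)

    BA-BooleanPart : BA BooleanPart.Fix
    BA-BooleanPart = BooleanPart.VBCA-Fix v ,
      lift λ ρ → BooleanPart.fixed-≡ (trans (J₂-idem (proj₁ (ρ 0))) (proj₂ (ρ 0)))

    𝕍⇒BA⊔SL : (BA ⊔ᵛ SL) A
    𝕍⇒BA⊔SL s t ⊨BA ⊨SL = lift λ ρ → begin
      ⟦ s ⟧ A ρ                             ≡⟨ J₂∧∨𝟏-split _ ⟩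
      J₂ᴬ (⟦ s ⟧ A ρ) ∧ᴬ (⟦ s ⟧ A ρ ∨ᴬ 𝟏ᴬ)  ≡⟨ cong₂ _∧ᴬ_
        (BooleanPart.Fix-⊨⇒ {s} {t} (⊨BA _ BA-BooleanPart) ρ)
        (SemilatticePart.Fix-⊨⇒ {s} {t} (⊨SL _ SL-SemilatticePart) ρ) ⟩
      J₂ᴬ (⟦ t ⟧ A ρ) ∧ᴬ (⟦ t ⟧ A ρ ∨ᴬ 𝟏ᴬ)  ≡⟨ J₂∧∨𝟏-split _ ⟨
      ⟦ t ⟧ A ρ                             ∎
      where open ≡-Reasoning

J₂¬-BA : Id BA (J₂ₜ (¬ₜ x₀)) (¬ₜ (J₂ₜ x₀))
J₂¬-BA B (_ , lift J₂≈id) ρ = trans (J₂≈id λ _ → ¬_ B (ρ 0)) (cong (¬_ B) (sym (J₂≈id ρ)))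

J₂¬-SL : Id SL (J₂ₜ (¬ₜ x₀)) (¬ₜ (J₂ₜ x₀))
J₂¬-SL B (v , lift J₂≈𝟏) ρ = begin
  J₂ B (¬_ B (ρ 0))  ≡⟨ J₂≈𝟏 (λ _ → ¬_ B (ρ 0)) ⟩
  𝟏 B                ≡⟨ J₂≈𝟏 (λ _ → 𝟎 B) ⟨
  J₂ B (𝟎 B)         ≡⟨ J₂-𝟎 ⟩
  𝟎 B                ≡⟨ ¬-𝟏 ⟨
  ¬_ B (𝟏 B)         ≡⟨ cong (¬_ B) (J₂≈𝟏 ρ) ⟨
  ¬_ B (J₂ B (ρ 0))  ∎
  where open ≡-Reasoning
        open VBCA-Algebra v

BA⊔SL⇒VBCA : ∀ {A} → (BA ⊔ᵛ SL) A → VBCA A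
BA⊔SL⇒VBCA H = lift λ s t WKe⊨s≈t →
  lower (H s t (λ B b → lower (proj₁ b) s t WKe⊨s≈t) (λ B b → lower (proj₁ b) s t WKe⊨s≈t))

corollary4p14 : 𝕍 ≐ (BA ⊔ᵛ SL)
corollary4p14 A =
  (λ { (v , lift J₂¬) → VBCA-Algebra.𝕍⇒BA⊔SL v (λ a → J₂¬ λ _ → a) })
  , λ H → BA⊔SL⇒VBCA H , lift (lower (H (J₂ₜ (¬ₜ x₀)) (¬ₜ (J₂ₜ x₀)) J₂¬-BA J₂¬-SL))
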